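{- Let $G$ be a finite simple graph and $u\in V(G)$. Let $\mathcal{B}_u$ be the set of induced subgraphs $H$ of $G$ that are connected, bipartite, and contain the vertex $u$. For $H\in\mathcal{B}_u$, let $A(H)$ be the colour class of $H$ containing $u$ and $B(H)$ the other colour class, and let $a(H)=|A(H)|$, $b(H)=|B(H)|$. Then \[ I(G,x)\,I(G-u,y)-I(G-u,x)\,I(G,y)=\sum_{H\in\mathcal{B}_u} I(G-N[H],x)\,I(G-N[H],y)\,\bigl(x^{a(H)}y^{b(H)}-x^{b(H)}y^{a(H)}\bigr). \]
   Context: For a graph $G$, the independence polynomial is $I(G,x)=\sum_{k\ge 0}a_k(G)x^k$, where $a_0(G)=1$ and for $k\ge1$, $a_k(G)$ is the number of independent sets of $G$ of size $k$ (so the graph with no vertices has $I=1$). For $S\subseteq V(G)$, $G-S$ denotes the induced subgraph of $G$ on $V(G)\setminus S$; $G-u$ means $G-\{u\}$. For an induced subgraph $H$, $N[H]=V(H)\cup N_G(V(H))$ is the closed neighbourhood of its vertex set in $G$. Since $H$ is connected and bipartite, its bipartition into two colour classes is unique. -}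

module Defs where

open import Level using (Level)
open import Data.Nat using (ℕ; zero; suc)
open import Data.Bool using (Bool; true; false; _∧_; _∨_; not; if_then_else_)
open import Data.Bool.Properties using () renaming (_≟_ to _≟ᵇ_)
open import Data.Fin using (Fin)
open import Data.Fin.Properties using (any?; all?)
open import Data.Fin.Subset using (Subset; _∈_; _⊆_; ∣_∣; _─_)
open import Data.Fin.Subset.Properties using (_∈?_; _⊆?_)
open import Data.Vec using (Vec; []; _∷_; tabulate)
open import Data.List using (List; []; _∷_; map; _++_; foldr; filter)
open import Data.Product using (_×_; _,_; ∃)
open import Relation.Nullary using (Dec; does)
open import Relation.Nullary.Decidable using (_→-dec_; _×-dec_)
open import Relation.Binary.PropositionalEquality using (_≡_)
open import Algebra.Bundles using (CommutativeRing)

record Graph (n : ℕ) : Set where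
  field
    adj    : Fin n → Fin n → Bool
    sym    : ∀ i j → adj i j ≡ adj j i
    irrefl : ∀ i → adj i i ≡ false
open Graph public

Independent : ∀ {n} → Graph n → Subset n → Set
Independent G T = ∀ i j → i ∈ T → j ∈ T → adj G i j ≡ false

independent? : ∀ {n} (G : Graph n) (T : Subset n) → Dec (Independent G T)
independent? G T =
  all? λ i → all? λ j → (i ∈? T) →-dec ((j ∈? T) →-dec (adj G i j ≟ᵇ false))

allSubsets : (n : ℕ) → List (Subset n)
allSubsets zero    = [] ∷ []
allSubsets (suc n) = map (true ∷_) (allSubsets n) ++ map (false ∷_) (allSubsets n)

module _ {c ℓ : Level} (R : CommutativeRing c ℓ) where
  open CommutativeRing R

  pow : Carrier → ℕ → Carrier
  pow x zero    = 1#
  pow x (suc k) = x * pow x k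

  sumR : List Carrier → Carrier
  sumR = foldr _+_ 0#

  indPoly : ∀ {n} → Graph n → Subset n → Carrier → Carrier
  indPoly {n} G W x =
    sumR (map (λ T → pow x ∣ T ∣)
              (filter (λ T → (T ⊆? W) ×-dec independent? G T) (allSubsets n)))

closedNbhd : ∀ {n} → Graph n → Subset n → Subset n
closedNbhd G S =
  tabulate λ v → does (v ∈? S) ∨ does (any? λ w → (w ∈? S) ×-dec (adj G v w ≟ᵇ true))

data Walk {n : ℕ} (G : Graph n) (S : Subset n) : Fin n → Fin n → Set where
  here : ∀ {v} → v ∈ S → Walk G S v v
  step : ∀ {v w z} → v ∈ S → adj G v w ≡ true → Walk G S w z → Walk G S v z

Connected : ∀ {n} → Graph n → Subset n → Set
Connected G S = ∀ v w → v ∈ S → w ∈ S → Walk G S v w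

-- (S , A) indexes an element H = G[S] of 𝓑_u together with its colour class
-- A = A(H) containing u: G[S] is connected, contains u, and (A , S ─ A) is a
-- proper 2-colouring of G[S] (so G[S] is bipartite) with u ∈ A.  Since G[S] is
-- connected, such A is unique, so these pairs correspond bijectively to 𝓑_u.
InB : ∀ {n} → Graph n → Fin n → Subset n × Subset n → Set
InB G u (S , A) =
  u ∈ S × Connected G S × A ⊆ S × u ∈ A ×
  Independent G A × Independent G (S ─ A)

module Submission where

-- Let D(z) be the sum of z^|T| over the independent sets T of G containing u. Then
-- I(G,z) = I(G−u,z) + D(z), so the left-hand side equals D(x) I(G−u,y) − D(y) I(G−u,x).
-- A pair (T₁, T₂) of independent sets with u ∈ T₁ and u ∉ T₂ determines H ∈ 𝓑_u as the component
-- of u in G[T₁ △ T₂], with A(H) = V(H) ∩ T₁ and B(H) = V(H) ∩ T₂, and what remains of T₁ and T₂ is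
-- an arbitrary pair of independent sets of G − N[H]. Hence
-- D(x) I(G−u,y) = Σ_H I(G−N[H],x) I(G−N[H],y) x^a(H) y^b(H), and antisymmetrising gives the identity.

open import Defs renaming (sym to adj-sym)
open import Data.Nat as ℕ using (ℕ; zero; suc)
import Data.Nat.Properties as ℕ
open import Data.Bool using (true; false; _∨_; if_then_else_)
open import Data.Bool.Properties using (¬-not) renaming (_≟_ to _≟ᵇ_)
open import Data.Fin using (Fin)
open import Data.Fin.Properties using (any?)
open import Data.Fin.Subset using (Subset; _∈_; _∉_; _⊆_; ∣_∣; _─_; _∪_; _∩_; ∁; ⁅_⁆; ⊤)
open import Data.Fin.Subset.Properties
  using (_∈?_; _⊆?_; drop-∷-⊆; ⊆-antisym; ⊆⊤; ∣p∣≤n; p⊂q⇒∣p∣<∣q∣; x∈p∧x∉q⇒x∈p─q; p─q⊆p;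
         x∈p∩q⁺; x∈p∩q⁻; p∩q⊆p; p∩q⊆q; p⊆p∪q; x∈p∪q⁺; x∈p∪q⁻; x∈⁅x⁆; x∈⁅y⁆⇒x≡y;
         x∈∁p⇒x∉p; x∉p⇒x∈∁p)
open import Data.Vec using ([]; _∷_; here; there)
open import Data.Vec.Properties using (∷-injectiveʳ; []=⇒lookup; lookup⇒[]=; lookup∘tabulate; ≡-dec)
open import Data.List using (List; []; _∷_; map; filter)
open import Data.List.Membership.Propositional using () renaming (_∈_ to _∈ₗ_)
open import Data.List.Membership.Propositional.Properties using (∈-map⁺; ∈-map⁻; ∈-++⁺ˡ; ∈-++⁺ʳ)
import Data.List.Relation.Unary.Any as Any
open import Data.List.Relation.Unary.All using ([]; _∷_)
import Data.List.Relation.Unary.All as All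
open import Data.List.Relation.Unary.Unique.Propositional using (Unique; []; _∷_)
import Data.List.Relation.Unary.Unique.Propositional.Properties as Unique
open import Data.Product using (_×_; _,_; proj₁; proj₂; ∃)
open import Data.Sum using (_⊎_; inj₁; inj₂; [_,_])
import Data.Sum as Sum
open import Data.Empty using (⊥-elim)
open import Relation.Nullary using (Dec; yes; no; does; ¬_; ¬?; contradiction)
open import Relation.Nullary.Decidable using (_×-dec_; _⊎-dec_)
open import Relation.Unary using (Decidable)
open import Relation.Binary.Definitions using (DecidableEquality)
open import Relation.Binary.PropositionalEquality using (_≡_; _≢_; refl; sym; trans; cong; cong₂; subst)
open import Function using (_∘_)
open import Function.Bundles using (_⇔_; Equivalence; mk⇔)
open import Algebra.Bundles using (CommutativeRing; Ring)
import Algebra.Properties.AbelianGroup as AbelianGroupProperties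
import Algebra.Properties.CommutativeSemigroup as CommutativeSemigroupProperties
import Algebra.Properties.RingWithoutOne as RingWithoutOneProperties
import Relation.Binary.Reasoning.Setoid as SetoidReasoning

allSubsets-complete : ∀ {n} (T : Subset n) → T ∈ₗ allSubsets n
allSubsets-complete {zero}  []          = Any.here refl
allSubsets-complete {suc n} (true ∷ T)  = ∈-++⁺ˡ (∈-map⁺ (true ∷_) (allSubsets-complete T))
allSubsets-complete {suc n} (false ∷ T) =
  ∈-++⁺ʳ (map (true ∷_) (allSubsets n)) (∈-map⁺ (false ∷_) (allSubsets-complete T))

allSubsets-unique : ∀ n → Unique (allSubsets n)
allSubsets-unique zero    = [] ∷ []
allSubsets-unique (suc n) =
  Unique.++⁺ (Unique.map⁺ ∷-injectiveʳ (allSubsets-unique n))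
             (Unique.map⁺ ∷-injectiveʳ (allSubsets-unique n)) heads-differ
  where
  heads-differ : ∀ {T} → ¬ (T ∈ₗ map (true ∷_) (allSubsets n) × T ∈ₗ map (false ∷_) (allSubsets n))
  heads-differ (p , q) with ∈-map⁻ (true ∷_) p | ∈-map⁻ (false ∷_) q
  ... | _ , _ , refl | _ , _ , ()

x∈p─q⇒x∉q : ∀ {n} {x : Fin n} (p q : Subset n) → x ∈ p ─ q → x ∉ q
x∈p─q⇒x∉q (_ ∷ p) (_    ∷ q) (there x∈p─q) (there x∈q) = x∈p─q⇒x∉q p q x∈p─q x∈q
x∈p─q⇒x∉q (_ ∷ p) (true ∷ q) ()            here

∣p∪q∣≡∣p∣+∣q∣ : ∀ {n} (p q : Subset n) → (∀ {x} → x ∈ p → x ∉ q) → ∣ p ∪ q ∣ ≡ ∣ p ∣ ℕ.+ ∣ q ∣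
∣p∪q∣≡∣p∣+∣q∣ []          []          _        = refl
∣p∪q∣≡∣p∣+∣q∣ (true ∷ p)  (true ∷ q)  disjoint = contradiction here (disjoint here)
∣p∪q∣≡∣p∣+∣q∣ (true ∷ p)  (false ∷ q) disjoint =
  cong suc (∣p∪q∣≡∣p∣+∣q∣ p q λ x∈p x∈q → disjoint (there x∈p) (there x∈q))
∣p∪q∣≡∣p∣+∣q∣ (false ∷ p) (true ∷ q)  disjoint =
  trans (cong suc (∣p∪q∣≡∣p∣+∣q∣ p q λ x∈p x∈q → disjoint (there x∈p) (there x∈q)))
        (sym (ℕ.+-suc ∣ p ∣ ∣ q ∣))
∣p∪q∣≡∣p∣+∣q∣ (false ∷ p) (false ∷ q) disjoint =
  ∣p∪q∣≡∣p∣+∣q∣ p q λ x∈p x∈q → disjoint (there x∈p) (there x∈q)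

p∪[q─p]≡q : ∀ {n} (p q : Subset n) → p ⊆ q → p ∪ (q ─ p) ≡ q
p∪[q─p]≡q []          []          _   = refl
p∪[q─p]≡q (true ∷ p)  (true ∷ q)  p⊆q = cong (true ∷_) (p∪[q─p]≡q p q (drop-∷-⊆ p⊆q))
p∪[q─p]≡q (true ∷ p)  (false ∷ q) p⊆q with p⊆q here
... | ()
p∪[q─p]≡q (false ∷ p) (true ∷ q)  p⊆q = cong (true ∷_) (p∪[q─p]≡q p q (drop-∷-⊆ p⊆q))
p∪[q─p]≡q (false ∷ p) (false ∷ q) p⊆q = cong (false ∷_) (p∪[q─p]≡q p q (drop-∷-⊆ p⊆q))

[p∪q]─p≡q : ∀ {n} (p q : Subset n) → (∀ {x} → x ∈ p → x ∉ q) → (p ∪ q) ─ p ≡ q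
[p∪q]─p≡q []          []          _        = refl
[p∪q]─p≡q (true ∷ p)  (true ∷ q)  disjoint = contradiction here (disjoint here)
[p∪q]─p≡q (true ∷ p)  (false ∷ q) disjoint =
  cong (false ∷_) ([p∪q]─p≡q p q λ x∈p x∈q → disjoint (there x∈p) (there x∈q))
[p∪q]─p≡q (false ∷ p) (true ∷ q)  disjoint =
  cong (true ∷_) ([p∪q]─p≡q p q λ x∈p x∈q → disjoint (there x∈p) (there x∈q))
[p∪q]─p≡q (false ∷ p) (false ∷ q) disjoint =
  cong (false ∷_) ([p∪q]─p≡q p q λ x∈p x∈q → disjoint (there x∈p) (there x∈q))

x∉p⇒p⊆∁⁅x⁆ : ∀ {n} {x : Fin n} {p : Subset n} → x ∉ p → p ⊆ ∁ ⁅ x ⁆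
x∉p⇒p⊆∁⁅x⁆ {x = x} {p} x∉p y∈p = x∉p⇒x∈∁p λ y∈⁅x⁆ → x∉p (subst (_∈ p) (x∈⁅y⁆⇒x≡y x y∈⁅x⁆) y∈p)

p⊆∁⁅x⁆⇒x∉p : ∀ {n} {x : Fin n} {p : Subset n} → p ⊆ ∁ ⁅ x ⁆ → x ∉ p
p⊆∁⁅x⁆⇒x∉p {x = x} p⊆∁⁅x⁆ x∈p = x∈∁p⇒x∉p (p⊆∁⁅x⁆ x∈p) (x∈⁅x⁆ x)

module ListSum {c ℓ} (R : CommutativeRing c ℓ) where

  open CommutativeRing R renaming (refl to ≈-refl; sym to ≈-sym; trans to ≈-trans)
  open AbelianGroupProperties +-abelianGroup using (ε⁻¹≈ε; ⁻¹-∙-comm)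
  open CommutativeSemigroupProperties +-commutativeSemigroup using (interchange)
  open SetoidReasoning setoid

  private variable
    A B P Q Q′ : Set
    v w : Carrier
    f g : A → Carrier

  ∑ : List A → (A → Carrier) → Carrier
  ∑ xs f = sumR R (map f xs)

  syntax ∑ xs (λ x → e) = ∑[ x ← xs ] e

  when : Dec P → Carrier → Carrier
  when d v = if does d then v else 0#

  when-yes : (d : Dec P) → P → when d v ≡ v
  when-yes (yes _) _ = refl
  when-yes (no ¬p) p = contradiction p ¬p

  when-no : (d : Dec P) → ¬ P → when d v ≡ 0#
  when-no (yes p) ¬p = contradiction p ¬p
  when-no (no _)  _  = refl

  when-cong : (d : Dec P) → (P → v ≈ w) → when d v ≈ when d w
  when-cong (yes p) v≈w = v≈w p
  when-cong (no _)  _   = ≈-refl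

  when-*ʳ : (d : Dec P) → when d v * w ≈ when d (v * w)
  when-*ʳ (yes _) = ≈-refl
  when-*ʳ (no _)  = zeroˡ _

  when-*-when : (d : Dec P) (e : Dec Q) → when d v * when e w ≈ when (d ×-dec e) (v * w)
  when-*-when (yes _) (yes _) = ≈-refl
  when-*-when (yes _) (no _)  = zeroʳ _
  when-*-when (no _)  _       = zeroˡ _

  when-⊎ : (d : Dec P) (e : Dec Q) (e′ : Dec Q′) → P ⇔ (Q ⊎ Q′) → ¬ (Q × Q′) →
           when d v ≈ when e v + when e′ v
  when-⊎ (yes _) (yes q) (yes q′) _  exclusive = contradiction (q , q′) exclusive
  when-⊎ (yes _) (yes _) (no _)   _  _ = ≈-sym (+-identityʳ _)
  when-⊎ (yes _) (no _)  (yes _)  _  _ = ≈-sym (+-identityˡ _)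
  when-⊎ (yes p) (no ¬q) (no ¬q′) P⇔ _ = ⊥-elim ([ ¬q , ¬q′ ] (Equivalence.to P⇔ p))
  when-⊎ (no ¬p) (yes q) _        P⇔ _ = contradiction (Equivalence.from P⇔ (inj₁ q)) ¬p
  when-⊎ (no ¬p) (no _)  (yes q′) P⇔ _ = contradiction (Equivalence.from P⇔ (inj₂ q′)) ¬p
  when-⊎ (no _)  (no _)  (no _)   _  _ = ≈-sym (+-identityˡ 0#)

  ∑-cong : (xs : List A) → (∀ x → x ∈ₗ xs → f x ≈ g x) → ∑ xs f ≈ ∑ xs g
  ∑-cong []       _   = ≈-refl
  ∑-cong (x ∷ xs) f≈g = +-cong (f≈g x (Any.here refl)) (∑-cong xs λ y y∈ → f≈g y (Any.there y∈))

  ∑-zero : (xs : List A) → (∀ x → x ∈ₗ xs → f x ≈ 0#) → ∑ xs f ≈ 0#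
  ∑-zero []       _   = ≈-refl
  ∑-zero (x ∷ xs) f≈0 =
    ≈-trans (+-cong (f≈0 x (Any.here refl)) (∑-zero xs λ y y∈ → f≈0 y (Any.there y∈))) (+-identityˡ 0#)

  ∑-distrib-+ : (xs : List A) (f g : A → Carrier) → ∑[ x ← xs ] (f x + g x) ≈ ∑ xs f + ∑ xs g
  ∑-distrib-+ []       f g = ≈-sym (+-identityˡ 0#)
  ∑-distrib-+ (x ∷ xs) f g = begin
    (f x + g x) + ∑[ y ← xs ] (f y + g y) ≈⟨ +-congˡ (∑-distrib-+ xs f g) ⟩
    (f x + g x) + (∑ xs f + ∑ xs g)       ≈⟨ interchange _ _ _ _ ⟩
    (f x + ∑ xs f) + (g x + ∑ xs g)       ∎

  ∑-distrib-neg : (xs : List A) (f : A → Carrier) → ∑[ x ← xs ] (- f x) ≈ - ∑ xs f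
  ∑-distrib-neg []       f = ≈-sym ε⁻¹≈ε
  ∑-distrib-neg (x ∷ xs) f = ≈-trans (+-congˡ (∑-distrib-neg xs f)) (⁻¹-∙-comm (f x) _)

  ∑-distrib-─ : (xs : List A) (f g : A → Carrier) → ∑[ x ← xs ] (f x - g x) ≈ ∑ xs f - ∑ xs g
  ∑-distrib-─ xs f g = ≈-trans (∑-distrib-+ xs f (λ x → - g x)) (+-congˡ (∑-distrib-neg xs g))

  *-distribˡ-∑ : (xs : List A) (a : Carrier) (f : A → Carrier) → a * ∑ xs f ≈ ∑[ x ← xs ] (a * f x)
  *-distribˡ-∑ []       a f = zeroʳ a
  *-distribˡ-∑ (x ∷ xs) a f = ≈-trans (distribˡ a (f x) _) (+-congˡ (*-distribˡ-∑ xs a f))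

  *-distribʳ-∑ : (xs : List A) (a : Carrier) (f : A → Carrier) → ∑ xs f * a ≈ ∑[ x ← xs ] (f x * a)
  *-distribʳ-∑ xs a f =
    ≈-trans (*-comm _ a) (≈-trans (*-distribˡ-∑ xs a f) (∑-cong xs λ x _ → *-comm a (f x)))

  ∑-*-∑ : (xs : List A) (ys : List B) (f : A → Carrier) (g : B → Carrier) →
          ∑ xs f * ∑ ys g ≈ ∑[ x ← xs ] ∑[ y ← ys ] (f x * g y)
  ∑-*-∑ xs ys f g = ≈-trans (*-distribʳ-∑ xs _ f) (∑-cong xs λ x _ → *-distribˡ-∑ ys (f x) g)

  ∑-comm : (xs : List A) (ys : List B) (f : A → B → Carrier) →
           ∑[ x ← xs ] ∑[ y ← ys ] f x y ≈ ∑[ y ← ys ] ∑[ x ← xs ] f x y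
  ∑-comm []       ys f = ≈-sym (∑-zero ys λ _ _ → ≈-refl)
  ∑-comm (x ∷ xs) ys f =
    ≈-trans (+-congˡ (∑-comm xs ys f)) (≈-sym (∑-distrib-+ ys (f x) λ y → ∑[ x′ ← xs ] f x′ y))

  ∑-filter : {P : A → Set} (P? : Decidable P) (xs : List A) (f : A → Carrier) →
             ∑ (filter P? xs) f ≈ ∑[ x ← xs ] when (P? x) (f x)
  ∑-filter P? []       f = ≈-refl
  ∑-filter P? (x ∷ xs) f with P? x
  ... | yes _ = +-congˡ (∑-filter P? xs f)
  ... | no _  = ≈-trans (∑-filter P? xs f) (≈-sym (+-identityˡ _))

  ∑-single : (xs : List A) → Unique xs → {a : A} → a ∈ₗ xs →
             (∀ x → x ∈ₗ xs → x ≢ a → f x ≈ 0#) → ∑ xs f ≈ f a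
  ∑-single (x ∷ xs) (x∉xs ∷ _) (Any.here refl) f≈0 =
    ≈-trans (+-congˡ (∑-zero xs λ y y∈ → f≈0 y (Any.there y∈) λ y≡x → All.lookup x∉xs y∈ (sym y≡x)))
            (+-identityʳ _)
  ∑-single (x ∷ xs) (x∉xs ∷ xs-unique) (Any.there a∈) f≈0 =
    ≈-trans (+-congʳ (f≈0 x (Any.here refl) (All.lookup x∉xs a∈)))
            (≈-trans (+-identityˡ _) (∑-single xs xs-unique a∈ λ y y∈ → f≈0 y (Any.there y∈)))

  ∑-when-unique : {P : Set} {Q : A → Set} (xs : List A) → Unique xs →
                  (Q? : Decidable Q) (P? : Dec P) →
                  (P → ∃ λ x → x ∈ₗ xs × Q x) →
                  (∀ {x} → x ∈ₗ xs → Q x → P) →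
                  (∀ {x x′} → x ∈ₗ xs → x′ ∈ₗ xs → Q x → Q x′ → x ≡ x′) →
                  ∑[ x ← xs ] when (Q? x) v ≈ when P? v
  ∑-when-unique xs xs-unique Q? P? witness sound unique with P?
  ... | yes p = let (x₀ , x₀∈ , q₀) = witness p in
    ≈-trans (∑-single xs xs-unique x₀∈ λ x x∈ x≢x₀ →
               reflexive (when-no (Q? x) λ q → x≢x₀ (unique x∈ x₀∈ q q₀)))
            (reflexive (when-yes (Q? x₀) q₀))
  ... | no ¬p = ∑-zero xs λ x x∈ → reflexive (when-no (Q? x) λ q → ¬p (sound x∈ q))

  ∑-reindex : {P Q : A → Set} (xs : List A) → Unique xs → (∀ x → x ∈ₗ xs) → DecidableEquality A →
              (P? : Decidable P) (Q? : Decidable Q) (φ ψ : A → A) →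
              (∀ {x} → P x → Q (φ x)) → (∀ {y} → Q y → P (ψ y)) →
              (∀ {x} → P x → ψ (φ x) ≡ x) → (∀ {y} → Q y → φ (ψ y) ≡ y) →
              (f : A → Carrier) →
              ∑[ x ← xs ] when (P? x) (f (φ x)) ≈ ∑[ y ← xs ] when (Q? y) (f y)
  ∑-reindex xs xs-unique xs-complete _≟_ P? Q? φ ψ P⇒Qφ Q⇒Pψ ψ∘φ φ∘ψ f = begin
    ∑[ x ← xs ] when (P? x) (f (φ x))                       ≈⟨ ∑-cong xs (λ x _ → ≈-sym (graph-sum x)) ⟩
    ∑[ x ← xs ] ∑[ y ← xs ] when (P? x ×-dec y ≟ φ x) (f y) ≈⟨ ∑-comm xs xs _ ⟩
    ∑[ y ← xs ] ∑[ x ← xs ] when (P? x ×-dec y ≟ φ x) (f y) ≈⟨ ∑-cong xs (λ y _ → fibre-sum y) ⟩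
    ∑[ y ← xs ] when (Q? y) (f y)                           ∎
    where
    graph-sum : ∀ x → ∑[ y ← xs ] when (P? x ×-dec y ≟ φ x) (f y) ≈ when (P? x) (f (φ x))
    graph-sum x with P? x
    ... | yes p = ≈-trans (∑-single xs xs-unique (xs-complete (φ x)) λ y _ y≢φx →
                             reflexive (when-no (yes p ×-dec y ≟ φ x) (y≢φx ∘ proj₂)))
                          (reflexive (when-yes (yes p ×-dec φ x ≟ φ x) (p , refl)))
    ... | no ¬p = ∑-zero xs λ y _ → reflexive (when-no {v = f y} (no ¬p ×-dec y ≟ φ x) (¬p ∘ proj₁))
    fibre-sum : ∀ y → ∑[ x ← xs ] when (P? x ×-dec y ≟ φ x) (f y) ≈ when (Q? y) (f y)
    fibre-sum y = ∑-when-unique xs xs-unique (λ x → P? x ×-dec y ≟ φ x) (Q? y)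
      (λ q → ψ y , xs-complete (ψ y) , Q⇒Pψ q , sym (φ∘ψ q))
      (λ { _ (p , refl) → P⇒Qφ p })
      (λ { _ _ (p , refl) (p′ , φx≡φx′) → trans (sym (ψ∘φ p)) (trans (cong ψ φx≡φx′) (ψ∘φ p′)) })

module InducedSubgraphs {n : ℕ} (G : Graph n) where

  private variable
    S S′ T T′ Z : Subset n
    u v w : Fin n
    X : Fin n → Set

  N[_] : Subset n → Subset n
  N[ S ] = closedNbhd G S

  adjacent-sym : adj G v w ≡ true → adj G w v ≡ true
  adjacent-sym {v} {w} e = trans (adj-sym G w v) e

  ∈N[]⁻ : v ∈ N[ S ] → v ∈ S ⊎ ∃ λ w → w ∈ S × adj G v w ≡ true
  ∈N[]⁻ {v} {S} v∈ = from-flag (v ∈? S) (any? _) (trans (sym (lookup∘tabulate _ v)) ([]=⇒lookup v∈))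
    where
    from-flag : (d : Dec (v ∈ S)) (e : Dec (∃ λ w → w ∈ S × adj G v w ≡ true)) →
                (does d ∨ does e) ≡ true → v ∈ S ⊎ ∃ λ w → w ∈ S × adj G v w ≡ true
    from-flag (yes v∈S) _          _ = inj₁ v∈S
    from-flag (no _)    (yes edge) _ = inj₂ edge
    from-flag (no _)    (no _)     ()

  ∈N[]⁺ : v ∈ S ⊎ (∃ λ w → w ∈ S × adj G v w ≡ true) → v ∈ N[ S ]
  ∈N[]⁺ {v} {S} v∈ = lookup⇒[]= v N[ S ] (trans (lookup∘tabulate _ v) (to-flag (v ∈? S) (any? _)))
    where
    to-flag : (d : Dec (v ∈ S)) (e : Dec (∃ λ w → w ∈ S × adj G v w ≡ true)) →
              (does d ∨ does e) ≡ true
    to-flag (yes _)  _          = refl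
    to-flag (no _)   (yes _)    = refl
    to-flag (no v∉S) (no ¬edge) = ⊥-elim ([ v∉S , ¬edge ] v∈)

  ∈∁N[]⁻ : v ∈ ∁ N[ S ] → v ∉ S × (∀ {w} → w ∈ S → adj G v w ≡ false)
  ∈∁N[]⁻ v∈ = (λ v∈S → x∈∁p⇒x∉p v∈ (∈N[]⁺ (inj₁ v∈S)))
            , (λ w∈S → ¬-not λ e → x∈∁p⇒x∉p v∈ (∈N[]⁺ (inj₂ (_ , w∈S , e))))

  ∈∁N[]⁺ : v ∉ S → (∀ {w} → w ∈ S → adj G v w ≡ false) → v ∈ ∁ N[ S ]
  ∈∁N[]⁺ {v} {S} v∉S non-adjacent = x∉p⇒x∈∁p λ v∈N → [ v∉S , no-edge ] (∈N[]⁻ v∈N)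
    where
    no-edge : ¬ ∃ λ w → w ∈ S × adj G v w ≡ true
    no-edge (_ , w∈S , e) with trans (sym e) (non-adjacent w∈S)
    ... | ()

  ∁N[]-disjoint : v ∈ S → v ∉ ∁ N[ S ]
  ∁N[]-disjoint v∈S v∈ = proj₁ (∈∁N[]⁻ v∈) v∈S

  IndependentIn : Subset n → Subset n → Set
  IndependentIn W T = T ⊆ W × Independent G T

  independentIn? : ∀ W T → Dec (IndependentIn W T)
  independentIn? W T = (T ⊆? W) ×-dec independent? G T

  Independent-⊆ : T′ ⊆ T → Independent G T → Independent G T′
  Independent-⊆ T′⊆T independent i j i∈ j∈ = independent i j (T′⊆T i∈) (T′⊆T j∈)

  Independent-glue : Z ⊆ S → Independent G Z → IndependentIn (∁ N[ S ]) (T ─ Z) → Independent G T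
  Independent-glue {Z} {S} {T} Z⊆S Z-independent (rest⊆ , rest-independent) i j i∈ j∈ with i ∈? Z | j ∈? Z
  ... | yes i∈Z | yes j∈Z = Z-independent i j i∈Z j∈Z
  ... | yes i∈Z | no  j∉Z = trans (adj-sym G i j) (proj₂ (∈∁N[]⁻ (rest⊆ (x∈p∧x∉q⇒x∈p─q j∈ j∉Z))) (Z⊆S i∈Z))
  ... | no  i∉Z | yes j∈Z = proj₂ (∈∁N[]⁻ (rest⊆ (x∈p∧x∉q⇒x∈p─q i∈ i∉Z))) (Z⊆S j∈Z)
  ... | no  i∉Z | no  j∉Z = rest-independent i j (x∈p∧x∉q⇒x∈p─q i∈ i∉Z) (x∈p∧x∉q⇒x∈p─q j∈ j∉Z)

  Extends : Subset n → Subset n → Subset n → Set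
  Extends S Z T = Z ⊆ T × IndependentIn (∁ N[ S ]) (T ─ Z)

  extends? : ∀ S Z T → Dec (Extends S Z T)
  extends? S Z T = (Z ⊆? T) ×-dec independentIn? (∁ N[ S ]) (T ─ Z)

  extends-outside : Extends S Z T → v ∈ T → v ∉ Z → v ∈ ∁ N[ S ]
  extends-outside (_ , rest⊆ , _) v∈T v∉Z = rest⊆ (x∈p∧x∉q⇒x∈p─q v∈T v∉Z)

  extends-inside : Extends S Z T → v ∈ S → v ∈ T → v ∈ Z
  extends-inside {Z = Z} {v = v} ext v∈S v∈T with v ∈? Z
  ... | yes v∈Z = v∈Z
  ... | no  v∉Z = contradiction (extends-outside ext v∈T v∉Z) (∁N[]-disjoint v∈S)

  walk-source : Walk G S v w → v ∈ S
  walk-source (here v∈S)     = v∈S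
  walk-source (step v∈S _ _) = v∈S

  walk-mono : S ⊆ S′ → Walk G S v w → Walk G S′ v w
  walk-mono S⊆S′ (here v∈S)        = here (S⊆S′ v∈S)
  walk-mono S⊆S′ (step v∈S e walk) = step (S⊆S′ v∈S) e (walk-mono S⊆S′ walk)

  walk-++ : Walk G S u v → Walk G S v w → Walk G S u w
  walk-++ (here _)          walk′ = walk′
  walk-++ (step u∈S e walk) walk′ = step u∈S e (walk-++ walk walk′)

  walk-reverse : Walk G S v w → Walk G S w v
  walk-reverse (here v∈S)        = here v∈S
  walk-reverse (step v∈S e walk) =
    walk-++ (walk-reverse walk) (step (walk-source walk) (adjacent-sym e) (here v∈S))

  Closed : (Fin n → Set) → Subset n → Set
  Closed X S = ∀ {v w} → X v → w ∈ S → adj G v w ≡ true → v ∈ S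

  walk-closed : (∀ {v} → v ∈ S → X v) → Closed X S′ → Walk G S v w → v ∈ S′ → w ∈ S′
  walk-closed S⊆X closed (here _)        v∈S′ = v∈S′
  walk-closed S⊆X closed (step _ e walk) v∈S′ =
    walk-closed S⊆X closed walk (closed (S⊆X (walk-source walk)) v∈S′ (adjacent-sym e))

  connected⊆closed : Connected G S → u ∈ S → (∀ {v} → v ∈ S → X v) → Closed X S′ → u ∈ S′ → S ⊆ S′
  connected⊆closed connected u∈S S⊆X closed u∈S′ v∈S =
    walk-closed S⊆X closed (connected _ _ u∈S v∈S) u∈S′

  record Explored (X : Fin n → Set) (u : Fin n) (S : Subset n) : Set where
    field
      root    : u ∈ S
      inside  : ∀ {v} → v ∈ S → X v
      reached : ∀ {v} → v ∈ S → Walk G S u v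

    connected : Connected G S
    connected _ _ v∈S w∈S = walk-++ (walk-reverse (reached v∈S)) (reached w∈S)

  record Component (X : Fin n → Set) (u : Fin n) : Set where
    field
      vertices : Subset n
      explored : Explored X u vertices
      closed   : Closed X vertices
    open Explored explored public

  explore-step : Explored X u S → X v → w ∈ S → adj G v w ≡ true → Explored X u (S ∪ ⁅ v ⁆)
  explore-step {X} {u} {S} {v} E Xv w∈S e = record
    { root    = grow (root E)
    ; inside  = inside′
    ; reached = reached′
    }
    where
    open Explored
    grow : S ⊆ S ∪ ⁅ v ⁆
    grow = p⊆p∪q ⁅ v ⁆
    v∈ : v ∈ S ∪ ⁅ v ⁆
    v∈ = x∈p∪q⁺ (inj₂ (x∈⁅x⁆ v))
    inside′ : ∀ {x} → x ∈ S ∪ ⁅ v ⁆ → X x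
    inside′ x∈ with x∈p∪q⁻ S ⁅ v ⁆ x∈
    ... | inj₁ x∈S = inside E x∈S
    ... | inj₂ x∈v with x∈⁅y⁆⇒x≡y v x∈v
    ...   | refl = Xv
    reached′ : ∀ {x} → x ∈ S ∪ ⁅ v ⁆ → Walk G (S ∪ ⁅ v ⁆) u x
    reached′ x∈ with x∈p∪q⁻ S ⁅ v ⁆ x∈
    ... | inj₁ x∈S = walk-mono grow (reached E x∈S)
    ... | inj₂ x∈v with x∈⁅y⁆⇒x≡y v x∈v
    ...   | refl = walk-++ (walk-mono grow (reached E w∈S)) (step (grow w∈S) (adjacent-sym e) (here v∈))

  -- Each round adds a vertex, so fuel n suffices.
  explore : Decidable X → (fuel : ℕ) → n ℕ.≤ ∣ S ∣ ℕ.+ fuel → Explored X u S → Component X u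
  explore {X} {S} X? fuel bound E
    with any? (λ v → X? v ×-dec ¬? (v ∈? S) ×-dec any? λ w → (w ∈? S) ×-dec (adj G v w ≟ᵇ true))
  ... | no no-frontier = record { vertices = S ; explored = E ; closed = closed }
    where
    closed : Closed X S
    closed {v} Xv w∈S e with v ∈? S
    ... | yes v∈S = v∈S
    ... | no  v∉S = contradiction (v , Xv , v∉S , _ , w∈S , e) no-frontier
  ... | yes (v , Xv , v∉S , w , w∈S , e) = continue fuel bound
    where
    grows : ∣ S ∣ ℕ.< ∣ S ∪ ⁅ v ⁆ ∣
    grows = p⊂q⇒∣p∣<∣q∣ (p⊆p∪q ⁅ v ⁆ , v , x∈p∪q⁺ (inj₂ (x∈⁅x⁆ v)) , v∉S)
    continue : (fuel : ℕ) → n ℕ.≤ ∣ S ∣ ℕ.+ fuel → Component X _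
    continue zero bound = contradiction
      (ℕ.≤-trans (∣p∣≤n (S ∪ ⁅ v ⁆)) (ℕ.≤-trans bound (ℕ.≤-reflexive (ℕ.+-identityʳ _)))) (ℕ.<⇒≱ grows)
    continue (suc fuel) bound = explore X? fuel
      (ℕ.≤-trans bound (ℕ.≤-trans (ℕ.≤-reflexive (ℕ.+-suc ∣ S ∣ fuel)) (ℕ.+-monoˡ-≤ fuel grows)))
      (explore-step E Xv w∈S e)

  component : Decidable X → X u → Component X u
  component {u = u} X? Xu = explore X? n (ℕ.m≤n+m n _) record
    { root    = x∈⁅x⁆ u
    ; inside  = λ v∈ → subst _ (sym (x∈⁅y⁆⇒x≡y u v∈)) Xu
    ; reached = λ v∈ → subst (Walk G ⁅ u ⁆ u) (sym (x∈⁅y⁆⇒x≡y u v∈)) (here (x∈⁅x⁆ u))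
    }

module Decomposition {n : ℕ} (G : Graph n) (u : Fin n) where

  open InducedSubgraphs G

  private variable
    S T₁ T₂ : Subset n
    v : Fin n

  Rooted : Subset n → Set
  Rooted T = u ∈ T × Independent G T

  rooted? : ∀ T → Dec (Rooted T)
  rooted? T = (u ∈? T) ×-dec independent? G T

  Splits : Subset n × Subset n → Subset n → Subset n → Set
  Splits (S , A) T₁ T₂ = Extends S A T₁ × Extends S (S ─ A) T₂

  splits? : ∀ p T₁ T₂ → Dec (Splits p T₁ T₂)
  splits? (S , A) T₁ T₂ = extends? S A T₁ ×-dec extends? S (S ─ A) T₂

  _△_ : Subset n → Subset n → Fin n → Set
  (T₁ △ T₂) v = (v ∈ T₁ × v ∉ T₂) ⊎ (v ∈ T₂ × v ∉ T₁)

  _△?_ : ∀ T₁ T₂ → Decidable (T₁ △ T₂)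
  (T₁ △? T₂) v = ((v ∈? T₁) ×-dec ¬? (v ∈? T₂)) ⊎-dec ((v ∈? T₂) ×-dec ¬? (v ∈? T₁))

  splits-sound : ∀ {p} → InB G u p → Splits p T₁ T₂ → Rooted T₁ × IndependentIn (∁ ⁅ u ⁆) T₂
  splits-sound {T₂ = T₂} {S , A} (u∈S , _ , A⊆S , u∈A , A-independent , B-independent)
               ((A⊆T₁ , rest₁) , ext₂@(_ , rest₂)) =
    (A⊆T₁ u∈A , Independent-glue A⊆S A-independent rest₁) ,
    (x∉p⇒p⊆∁⁅x⁆ u∉T₂ , Independent-glue (p─q⊆p S A) B-independent rest₂)
    where
    u∉T₂ : u ∉ T₂
    u∉T₂ u∈T₂ = x∈p─q⇒x∉q S A (extends-inside ext₂ u∈S u∈T₂) u∈A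

  splits⊆△ : ∀ {A} → Splits (S , A) T₁ T₂ → v ∈ S → (T₁ △ T₂) v
  splits⊆△ {S} {v = v} {A} (ext₁@(A⊆T₁ , _) , ext₂@(B⊆T₂ , _)) v∈S with v ∈? A
  ... | yes v∈A = inj₁ (A⊆T₁ v∈A , λ v∈T₂ → x∈p─q⇒x∉q S A (extends-inside ext₂ v∈S v∈T₂) v∈A)
  ... | no  v∉A = inj₂ (B⊆T₂ (x∈p∧x∉q⇒x∈p─q v∈S v∉A) , λ v∈T₁ → v∉A (extends-inside ext₁ v∈S v∈T₁))

  splits-closed : ∀ {A} → A ⊆ S → Splits (S , A) T₁ T₂ → Closed (T₁ △ T₂) S
  splits-closed {S} {A = A} A⊆S (ext₁ , ext₂) {v} v∈△ w∈S e with v ∈? S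
  ... | yes v∈S = v∈S
  ... | no  v∉S = contradiction (trans (sym e) (proj₂ (∈∁N[]⁻ v∈∁N) w∈S)) λ ()
    where
    v∈∁N : v ∈ ∁ N[ S ]
    v∈∁N = [ (λ (v∈T₁ , _) → extends-outside ext₁ v∈T₁ (v∉S ∘ A⊆S))
           , (λ (v∈T₂ , _) → extends-outside ext₂ v∈T₂ (v∉S ∘ p─q⊆p S A)) ] v∈△

  splits-A≡S∩T₁ : ∀ {A} → A ⊆ S → Splits (S , A) T₁ T₂ → A ≡ S ∩ T₁
  splits-A≡S∩T₁ {S} {T₁} A⊆S (ext₁@(A⊆T₁ , _) , _) =
    ⊆-antisym (λ v∈A → x∈p∩q⁺ (A⊆S v∈A , A⊆T₁ v∈A))
              (λ v∈ → let v∈S , v∈T₁ = x∈p∩q⁻ S T₁ v∈ in extends-inside ext₁ v∈S v∈T₁)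

  -- S is forced to be the component of u in G[T₁ △ T₂]: it is connected and closed there.
  splits-unique : ∀ {p p′} → InB G u p → Splits p T₁ T₂ → InB G u p′ → Splits p′ T₁ T₂ → p ≡ p′
  splits-unique {T₁} {p = S , A} {S′ , A′}
                (u∈S , S-connected , A⊆S , _) splits (u∈S′ , S′-connected , A′⊆S′ , _) splits′ =
    cong₂ _,_ S≡S′ (trans (splits-A≡S∩T₁ A⊆S splits)
                          (trans (cong (_∩ T₁) S≡S′) (sym (splits-A≡S∩T₁ A′⊆S′ splits′))))
    where
    S≡S′ : S ≡ S′
    S≡S′ = ⊆-antisym
      (connected⊆closed S-connected u∈S (splits⊆△ splits) (splits-closed A′⊆S′ splits′) u∈S′)
      (connected⊆closed S′-connected u∈S′ (splits⊆△ splits′) (splits-closed A⊆S splits) u∈S)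

  outside-closed⇒∈∁N[] : Independent G T₁ → Independent G T₂ → (∀ {w} → w ∈ S → (T₁ △ T₂) w) →
                         Closed (T₁ △ T₂) S → v ∈ T₁ → v ∉ S → v ∈ ∁ N[ S ]
  outside-closed⇒∈∁N[] {T₁} {T₂} {S} {v} T₁-independent T₂-independent S⊆△ closed v∈T₁ v∉S =
    ∈∁N[]⁺ v∉S non-adjacent
    where
    non-adjacent : ∀ {w} → w ∈ S → adj G v w ≡ false
    non-adjacent {w} w∈S with S⊆△ w∈S
    ... | inj₁ (w∈T₁ , _) = T₁-independent v w v∈T₁ w∈T₁
    ... | inj₂ (w∈T₂ , _) with v ∈? T₂
    ...   | yes v∈T₂ = T₂-independent v w v∈T₂ w∈T₂
    ...   | no  v∉T₂ = ¬-not λ e → v∉S (closed (inj₁ (v∈T₁ , v∉T₂)) w∈S e)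

  splits-exist : Rooted T₁ → IndependentIn (∁ ⁅ u ⁆) T₂ → ∃ λ p → InB G u p × Splits p T₁ T₂
  splits-exist {T₁} {T₂} (u∈T₁ , T₁-independent) (T₂⊆∁u , T₂-independent) =
    (S₀ , A₀) ,
    (root , connected , p∩q⊆p S₀ T₁ , x∈p∩q⁺ (root , u∈T₁) ,
     Independent-⊆ (p∩q⊆q S₀ T₁) T₁-independent , Independent-⊆ B₀⊆T₂ T₂-independent) ,
    (p∩q⊆q S₀ T₁ , rest₁⊆∁N , Independent-⊆ (p─q⊆p T₁ A₀) T₁-independent) ,
    (B₀⊆T₂ , rest₂⊆∁N , Independent-⊆ (p─q⊆p T₂ B₀) T₂-independent)
    where
    open Component (component (T₁ △? T₂) (inj₁ (u∈T₁ , p⊆∁⁅x⁆⇒x∉p T₂⊆∁u))) renaming (vertices to S₀)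
    A₀ B₀ : Subset n
    A₀ = S₀ ∩ T₁
    B₀ = S₀ ─ A₀
    B₀⊆T₂ : B₀ ⊆ T₂
    B₀⊆T₂ v∈B₀ with inside (p─q⊆p S₀ A₀ v∈B₀)
    ... | inj₁ (v∈T₁ , _) = contradiction (x∈p∩q⁺ (p─q⊆p S₀ A₀ v∈B₀ , v∈T₁)) (x∈p─q⇒x∉q S₀ A₀ v∈B₀)
    ... | inj₂ (v∈T₂ , _) = v∈T₂
    rest₁⊆∁N : T₁ ─ A₀ ⊆ ∁ N[ S₀ ]
    rest₁⊆∁N v∈ = outside-closed⇒∈∁N[] T₁-independent T₂-independent inside closed (p─q⊆p T₁ A₀ v∈)
                    λ v∈S₀ → x∈p─q⇒x∉q T₁ A₀ v∈ (x∈p∩q⁺ (v∈S₀ , p─q⊆p T₁ A₀ v∈))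
    rest₂⊆∁N : T₂ ─ B₀ ⊆ ∁ N[ S₀ ]
    rest₂⊆∁N {v} v∈ = outside-closed⇒∈∁N[] T₂-independent T₁-independent (Sum.swap ∘ inside)
                        (λ v∈△ → closed (Sum.swap v∈△)) v∈T₂ v∉S₀
      where
      v∈T₂ : v ∈ T₂
      v∈T₂ = p─q⊆p T₂ B₀ v∈
      v∉S₀ : v ∉ S₀
      v∉S₀ v∈S₀ with v ∈? A₀ | inside v∈S₀
      ... | no  v∉A₀ | _               = x∈p─q⇒x∉q T₂ B₀ v∈ (x∈p∧x∉q⇒x∈p─q v∈S₀ v∉A₀)
      ... | yes _    | inj₁ (_ , v∉T₂) = v∉T₂ v∈T₂
      ... | yes v∈A₀ | inj₂ (_ , v∉T₁) = v∉T₁ (p∩q⊆q S₀ T₁ v∈A₀)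

module IndependencePolynomial {c ℓ} (R : CommutativeRing c ℓ) {n : ℕ} (G : Graph n) (u : Fin n) where

  open CommutativeRing R renaming (refl to ≈-refl; sym to ≈-sym; trans to ≈-trans)
  open CommutativeSemigroupProperties *-commutativeSemigroup using (interchange)
  open RingWithoutOneProperties (Ring.ringWithoutOne ring) using (x[y-z]≈xy-xz)
  open SetoidReasoning setoid
  open ListSum R
  open InducedSubgraphs G
  open Decomposition G u

  infixr 8 _^_
  _^_ : Carrier → ℕ → Carrier
  _^_ = pow R

  ^-homo-+ : ∀ z a b → z ^ (a ℕ.+ b) ≈ z ^ a * z ^ b
  ^-homo-+ z zero    b = ≈-sym (*-identityˡ _)
  ^-homo-+ z (suc a) b = ≈-trans (*-congˡ (^-homo-+ z a b)) (≈-sym (*-assoc _ _ _))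

  I : Subset n → Carrier → Carrier
  I W z = indPoly R G W z

  𝒫 : List (Subset n)
  𝒫 = allSubsets n

  I≈∑ : ∀ W z → I W z ≈ ∑[ T ← 𝒫 ] when (independentIn? W T) (z ^ ∣ T ∣)
  I≈∑ W z = ∑-filter (independentIn? W) 𝒫 (λ T → z ^ ∣ T ∣)

  I*^≈∑-extends : ∀ {Z S} → Z ⊆ S → ∀ z →
            I (∁ N[ S ]) z * z ^ ∣ Z ∣ ≈ ∑[ T ← 𝒫 ] when (extends? S Z T) (z ^ ∣ T ∣)
  I*^≈∑-extends {Z} {S} Z⊆S z = begin
    I (∁ N[ S ]) z * z ^ ∣ Z ∣
      ≈⟨ *-congʳ (I≈∑ (∁ N[ S ]) z) ⟩
    ∑[ T ← 𝒫 ] when (independentIn? (∁ N[ S ]) T) (z ^ ∣ T ∣) * z ^ ∣ Z ∣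
      ≈⟨ *-distribʳ-∑ 𝒫 _ _ ⟩
    ∑[ T ← 𝒫 ] (when (independentIn? (∁ N[ S ]) T) (z ^ ∣ T ∣) * z ^ ∣ Z ∣)
      ≈⟨ ∑-cong 𝒫 (λ T _ → ≈-trans (when-*ʳ (independentIn? _ T)) (when-cong (independentIn? _ T) (merge T))) ⟩
    ∑[ T ← 𝒫 ] when (independentIn? (∁ N[ S ]) T) (z ^ ∣ Z ∪ T ∣)
      ≈⟨ ∑-reindex 𝒫 (allSubsets-unique n) allSubsets-complete (≡-dec _≟ᵇ_)
                   (independentIn? (∁ N[ S ])) (extends? S Z) (Z ∪_) (_─ Z)
                   (λ {T} T-ind → p⊆p∪q T , subst (IndependentIn (∁ N[ S ])) (sym (Z∪T─Z T-ind)) T-ind)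
                   proj₂ Z∪T─Z (λ {T} (Z⊆T , _) → p∪[q─p]≡q Z T Z⊆T) (λ T → z ^ ∣ T ∣) ⟩
    ∑[ T ← 𝒫 ] when (extends? S Z T) (z ^ ∣ T ∣) ∎
    where
    disjoint : ∀ {T} → T ⊆ ∁ N[ S ] → ∀ {v} → v ∈ Z → v ∉ T
    disjoint T⊆ v∈Z v∈T = ∁N[]-disjoint (Z⊆S v∈Z) (T⊆ v∈T)
    Z∪T─Z : ∀ {T} → IndependentIn (∁ N[ S ]) T → (Z ∪ T) ─ Z ≡ T
    Z∪T─Z {T} (T⊆ , _) = [p∪q]─p≡q Z T (disjoint T⊆)
    merge : ∀ T → IndependentIn (∁ N[ S ]) T → z ^ ∣ T ∣ * z ^ ∣ Z ∣ ≈ z ^ ∣ Z ∪ T ∣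
    merge T (T⊆ , _) = begin
      z ^ ∣ T ∣ * z ^ ∣ Z ∣         ≈⟨ *-comm _ _ ⟩
      z ^ ∣ Z ∣ * z ^ ∣ T ∣         ≈⟨ ^-homo-+ z ∣ Z ∣ ∣ T ∣ ⟨
      z ^ (∣ Z ∣ ℕ.+ ∣ T ∣)        ≡⟨ cong (z ^_) (∣p∪q∣≡∣p∣+∣q∣ Z T (disjoint T⊆)) ⟨
      z ^ ∣ Z ∪ T ∣                ∎

  rootedPoly : Carrier → Carrier
  rootedPoly z = ∑[ T ← 𝒫 ] when (rooted? T) (z ^ ∣ T ∣)

  I≈I[G-u]+rootedPoly : ∀ z → I ⊤ z ≈ I (∁ ⁅ u ⁆) z + rootedPoly z
  I≈I[G-u]+rootedPoly z = begin
    I ⊤ z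
      ≈⟨ I≈∑ ⊤ z ⟩
    ∑[ T ← 𝒫 ] when (independentIn? ⊤ T) (z ^ ∣ T ∣)
      ≈⟨ ∑-cong 𝒫 (λ T _ → when-⊎ (independentIn? ⊤ T) (independentIn? (∁ ⁅ u ⁆) T) (rooted? T)
                                    (u-split T) exclusive) ⟩
    ∑[ T ← 𝒫 ] (when (independentIn? (∁ ⁅ u ⁆) T) (z ^ ∣ T ∣) + when (rooted? T) (z ^ ∣ T ∣))
      ≈⟨ ∑-distrib-+ 𝒫 _ _ ⟩
    ∑[ T ← 𝒫 ] when (independentIn? (∁ ⁅ u ⁆) T) (z ^ ∣ T ∣) + rootedPoly z
      ≈⟨ +-congʳ (I≈∑ (∁ ⁅ u ⁆) z) ⟨
    I (∁ ⁅ u ⁆) z + rootedPoly z ∎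
    where
    u-split : ∀ T → IndependentIn ⊤ T ⇔ (IndependentIn (∁ ⁅ u ⁆) T ⊎ Rooted T)
    u-split T = mk⇔ to [ (λ (_ , T-ind) → ⊆⊤ , T-ind) , (λ (_ , T-ind) → ⊆⊤ , T-ind) ]
      where
      to : IndependentIn ⊤ T → IndependentIn (∁ ⁅ u ⁆) T ⊎ Rooted T
      to (_ , T-ind) with u ∈? T
      ... | yes u∈T = inj₂ (u∈T , T-ind)
      ... | no  u∉T = inj₁ (x∉p⇒p⊆∁⁅x⁆ u∉T , T-ind)
    exclusive : ∀ {T} → ¬ (IndependentIn (∁ ⁅ u ⁆) T × Rooted T)
    exclusive ((T⊆∁u , _) , u∈T , _) = p⊆∁⁅x⁆⇒x∉p T⊆∁u u∈T

  weight : Carrier → Carrier → Subset n × Subset n → Carrier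
  weight x y (S , A) = I (∁ N[ S ]) x * I (∁ N[ S ]) y * (x ^ ∣ A ∣ * y ^ ∣ S ─ A ∣)

  antisymmetrised : Carrier → Carrier → Subset n × Subset n → Carrier
  antisymmetrised x y (S , A) =
    I (∁ N[ S ]) x * I (∁ N[ S ]) y * (x ^ ∣ A ∣ * y ^ ∣ S ─ A ∣ - x ^ ∣ S ─ A ∣ * y ^ ∣ A ∣)

  module _ (L : List (Subset n × Subset n)) (L-unique : Unique L) (L⇔B : ∀ p → (p ∈ₗ L) ⇔ InB G u p) where

    ∑-weight : ∀ x y → ∑ L (weight x y) ≈ rootedPoly x * I (∁ ⁅ u ⁆) y
    ∑-weight x y = begin
      ∑ L (weight x y)
        ≈⟨ ∑-cong L (λ p p∈L → expand p (Equivalence.to (L⇔B p) p∈L)) ⟩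
      ∑[ p ← L ] ∑[ T₁ ← 𝒫 ] ∑[ T₂ ← 𝒫 ] when (splits? p T₁ T₂) (x ^ ∣ T₁ ∣ * y ^ ∣ T₂ ∣)
        ≈⟨ ∑-comm L 𝒫 _ ⟩
      ∑[ T₁ ← 𝒫 ] ∑[ p ← L ] ∑[ T₂ ← 𝒫 ] when (splits? p T₁ T₂) (x ^ ∣ T₁ ∣ * y ^ ∣ T₂ ∣)
        ≈⟨ ∑-cong 𝒫 (λ T₁ _ → ∑-comm L 𝒫 _) ⟩
      ∑[ T₁ ← 𝒫 ] ∑[ T₂ ← 𝒫 ] ∑[ p ← L ] when (splits? p T₁ T₂) (x ^ ∣ T₁ ∣ * y ^ ∣ T₂ ∣)
        ≈⟨ ∑-cong 𝒫 (λ T₁ _ → ∑-cong 𝒫 (λ T₂ _ → unique-split T₁ T₂)) ⟩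
      ∑[ T₁ ← 𝒫 ] ∑[ T₂ ← 𝒫 ] when (rooted? T₁ ×-dec independentIn? (∁ ⁅ u ⁆) T₂) (x ^ ∣ T₁ ∣ * y ^ ∣ T₂ ∣)
        ≈⟨ ∑-cong 𝒫 (λ T₁ _ → ∑-cong 𝒫 (λ T₂ _ → when-*-when (rooted? T₁) (independentIn? _ T₂))) ⟨
      ∑[ T₁ ← 𝒫 ] ∑[ T₂ ← 𝒫 ] (when (rooted? T₁) (x ^ ∣ T₁ ∣) * when (independentIn? (∁ ⁅ u ⁆) T₂) (y ^ ∣ T₂ ∣))
        ≈⟨ ∑-*-∑ 𝒫 𝒫 _ _ ⟨
      rootedPoly x * ∑[ T₂ ← 𝒫 ] when (independentIn? (∁ ⁅ u ⁆) T₂) (y ^ ∣ T₂ ∣)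
        ≈⟨ *-congˡ (I≈∑ (∁ ⁅ u ⁆) y) ⟨
      rootedPoly x * I (∁ ⁅ u ⁆) y ∎
      where
      expand : ∀ p → InB G u p →
               weight x y p ≈ ∑[ T₁ ← 𝒫 ] ∑[ T₂ ← 𝒫 ] when (splits? p T₁ T₂) (x ^ ∣ T₁ ∣ * y ^ ∣ T₂ ∣)
      expand (S , A) (_ , _ , A⊆S , _) = begin
        weight x y (S , A)
          ≈⟨ interchange _ _ _ _ ⟩
        (I (∁ N[ S ]) x * x ^ ∣ A ∣) * (I (∁ N[ S ]) y * y ^ ∣ S ─ A ∣)
          ≈⟨ *-cong (I*^≈∑-extends A⊆S x) (I*^≈∑-extends (p─q⊆p S A) y) ⟩
        ∑[ T₁ ← 𝒫 ] when (extends? S A T₁) (x ^ ∣ T₁ ∣) * ∑[ T₂ ← 𝒫 ] when (extends? S (S ─ A) T₂) (y ^ ∣ T₂ ∣)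
          ≈⟨ ∑-*-∑ 𝒫 𝒫 _ _ ⟩
        ∑[ T₁ ← 𝒫 ] ∑[ T₂ ← 𝒫 ] (when (extends? S A T₁) (x ^ ∣ T₁ ∣) * when (extends? S (S ─ A) T₂) (y ^ ∣ T₂ ∣))
          ≈⟨ ∑-cong 𝒫 (λ T₁ _ → ∑-cong 𝒫 (λ T₂ _ → when-*-when (extends? S A T₁) (extends? S (S ─ A) T₂))) ⟩
        ∑[ T₁ ← 𝒫 ] ∑[ T₂ ← 𝒫 ] when (splits? (S , A) T₁ T₂) (x ^ ∣ T₁ ∣ * y ^ ∣ T₂ ∣) ∎
      unique-split : ∀ T₁ T₂ → ∑[ p ← L ] when (splits? p T₁ T₂) (x ^ ∣ T₁ ∣ * y ^ ∣ T₂ ∣) ≈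
                               when (rooted? T₁ ×-dec independentIn? (∁ ⁅ u ⁆) T₂) (x ^ ∣ T₁ ∣ * y ^ ∣ T₂ ∣)
      unique-split T₁ T₂ =
        ∑-when-unique L L-unique (λ p → splits? p T₁ T₂) (rooted? T₁ ×-dec independentIn? (∁ ⁅ u ⁆) T₂)
        (λ (rooted , independent) → let p , inB , splits = splits-exist rooted independent
                                    in p , Equivalence.from (L⇔B p) inB , splits)
        (λ p∈L → splits-sound (Equivalence.to (L⇔B _) p∈L))
        (λ p∈L p′∈L splits splits′ →
           splits-unique (Equivalence.to (L⇔B _) p∈L) splits (Equivalence.to (L⇔B _) p′∈L) splits′)

    ∑-antisymmetrised : ∀ x y →
      ∑ L (antisymmetrised x y) ≈ rootedPoly x * I (∁ ⁅ u ⁆) y - rootedPoly y * I (∁ ⁅ u ⁆) x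
    ∑-antisymmetrised x y = begin
      ∑ L (antisymmetrised x y)                       ≈⟨ ∑-cong L (λ p _ → antisymmetrised≈ p) ⟩
      ∑[ p ← L ] (weight x y p - weight y x p)        ≈⟨ ∑-distrib-─ L _ _ ⟩
      ∑ L (weight x y) - ∑ L (weight y x)             ≈⟨ +-cong (∑-weight x y) (-‿cong (∑-weight y x)) ⟩
      rootedPoly x * I (∁ ⁅ u ⁆) y - rootedPoly y * I (∁ ⁅ u ⁆) x ∎
      where
      antisymmetrised≈ : ∀ p → antisymmetrised x y p ≈ weight x y p - weight y x p
      antisymmetrised≈ (S , A) =
        ≈-trans (x[y-z]≈xy-xz _ _ _)
                (+-congˡ (-‿cong (*-cong (*-comm _ _) (*-comm _ _))))

[a+b]c-a[c+d]≈bc-ad : ∀ {c ℓ} (R : CommutativeRing c ℓ) → let open CommutativeRing R in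
                      ∀ a b c d → (a + b) * c - a * (c + d) ≈ b * c - a * d
[a+b]c-a[c+d]≈bc-ad R a b c d = begin
  (a + b) * c - a * (c + d)                 ≈⟨ +-cong (distribʳ c a b) (-‿cong (distribˡ a c d)) ⟩
  (a * c + b * c) + - (a * c + a * d)       ≈⟨ +-congˡ (⁻¹-∙-comm (a * c) (a * d)) ⟨
  (a * c + b * c) + (- (a * c) + - (a * d)) ≈⟨ interchange _ _ _ _ ⟩
  (a * c + - (a * c)) + (b * c - a * d)     ≈⟨ +-congʳ (-‿inverseʳ (a * c)) ⟩
  0# + (b * c - a * d)                      ≈⟨ +-identityˡ _ ⟩
  b * c - a * d                             ∎
  where
  open CommutativeRing R
  open AbelianGroupProperties +-abelianGroup using (⁻¹-∙-comm)
  open CommutativeSemigroupProperties +-commutativeSemigroup using (interchange)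
  open SetoidReasoning setoid

theorem1p4 : ∀ {c ℓ} (R : CommutativeRing c ℓ) {n : ℕ} (G : Graph n) (u : Fin n)
  (L : List (Subset n × Subset n)) → Unique L →
  (∀ p → (p ∈ₗ L) ⇔ InB G u p) →
  ∀ x y →
  let open CommutativeRing R
      I : Subset n → CommutativeRing.Carrier R → CommutativeRing.Carrier R
      I W z = indPoly R G W z
      term : Subset n × Subset n → CommutativeRing.Carrier R
      term SA = let S = proj₁ SA
                    A = proj₂ SA
                    a = ∣ A ∣
                    b = ∣ S ─ A ∣
                    W = ∁ (closedNbhd G S)
                in I W x * I W y * (pow R x a * pow R y b - pow R x b * pow R y a)
  in I ⊤ x * I (∁ ⁅ u ⁆) y - I (∁ ⁅ u ⁆) x * I ⊤ y ≈ sumR R (map term L)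
theorem1p4 R G u L L-unique L⇔B x y = begin
  I ⊤ x * I G-u y - I G-u x * I ⊤ y
    ≈⟨ +-cong (*-congʳ (I≈I[G-u]+rootedPoly x)) (-‿cong (*-congˡ (I≈I[G-u]+rootedPoly y))) ⟩
  (I G-u x + rootedPoly x) * I G-u y - I G-u x * (I G-u y + rootedPoly y)
    ≈⟨ [a+b]c-a[c+d]≈bc-ad R _ _ _ _ ⟩
  rootedPoly x * I G-u y - I G-u x * rootedPoly y
    ≈⟨ +-congˡ (-‿cong (*-comm _ _)) ⟩
  rootedPoly x * I G-u y - rootedPoly y * I G-u x
    ≈⟨ ∑-antisymmetrised L L-unique L⇔B x y ⟨
  ∑ L (antisymmetrised x y) ∎
  where
  open CommutativeRing R
  open SetoidReasoning setoid
  open ListSum R using (∑)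
  open IndependencePolynomial R G u
  G-u : Subset _
  G-u = ∁ ⁅ u ⁆
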